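{- Assume that $(\mathbb P,\mathcal D,\bar E)$ is a model of sweetness with $\bar E=\langle E_n:n<\omega\rangle$ and $\mathcal D=\mathbb P$. Furthermore, suppose that any two compatible elements of $\mathbb P$ have a least upper bound. For finite sequences $\bar p=\langle p_\ell:\ell\le k\rangle\subseteq\mathbb P$ and $\bar n=\langle n_\ell:\ell\le k\rangle\subseteq\omega$ let $U(\bar p,\bar n)=\{q\in\mathbb P:\forall\ell\le k\ \exists q'\in[p_\ell]_{E_{n_\ell}}\ (q\le q')\}$, and let $\mathcal B$ be the collection of all such sets $U(\bar p,\bar n)$. Then $(\mathbb P,\mathcal B)$ is a model of iterable sweetness.
   Context: Forcing convention: a stronger condition is the larger one. A triple $(\mathbb P,\mathcal D,\bar E)$ is a model of sweetness if: $\mathbb P$ is a forcing notion and $\mathcal D\subseteq\mathbb P$ is dense; $\bar E=\langle E_n:n<\omega\rangle$ where each $E_n$ is an equivalence relation on $\mathcal D$ with countably many classes; the equivalence classes of each $E_n$ are directed and $E_{n+1}\subseteq E_n$; if $\{p_i:i\le\omega\}\subseteq\mathcal D$ and $p_i\,E_i\,p_\omega$ for all $i\in\omega$, then for every $n$ there is $q\ge p_\omega$ with $q\,E_n\,p_\omega$ and $p_i\le q$ for all $i\ge n$; and if $p,q\in\mathcal D$, $p\le q$, $n\in\omega$, then there is $k$ such that for every $p'\in[p]_{E_k}$ there is $q'\in[q]_{E_n}$ with $p'\le q'$. For a countable basis $\mathcal B$ of a topology on $\mathbb P$, $(\mathbb P,\mathcal B)$ is a model of iterable sweetness if: (i) $\mathcal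 B$ is closed under finite intersections; (ii) each $U\in\mathcal B$ is directed and downward closed ($p\le q\in U\Rightarrow p\in U$); (iii) if $\langle p_n:n\le\omega\rangle\subseteq U\in\mathcal B$ and $\langle p_n:n<\omega\rangle$ converges to $p_\omega$ in the topology generated by $\mathcal B$, then there is $p\in U$ with $p_n\le p$ for all $n\le\omega$. -}

module Defs where

open import Data.Nat using (ℕ; suc; _≤_)
open import Data.Fin using (Fin)
open import Data.Product using (Σ; ∃; _×_; _,_)
open import Relation.Binary.PropositionalEquality using (_≡_)
open import Relation.Binary.Structures using (IsEquivalence)

-- A forcing notion: a preorder. Convention: the stronger condition is the LARGER one.
record ForcingNotion : Set₁ where
  field
    Carrier : Set
    _≼_     : Carrier → Carrier → Set
    ≼-refl  : ∀ {p} → p ≼ p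
    ≼-trans : ∀ {p q r} → p ≼ q → q ≼ r → p ≼ r

module _ (ℙ : ForcingNotion) where
  open ForcingNotion ℙ

  Subset : Set₁
  Subset = Carrier → Set

  -- a relation has countably many (i.e. at most ℵ₀) classes:
  -- the classes inject into ℕ
  CountablyManyClasses : (Carrier → Carrier → Set) → Set
  CountablyManyClasses E = Σ (Carrier → ℕ) λ g → ∀ p q → g p ≡ g q → E p q

  DirectedClasses : (Carrier → Carrier → Set) → Set
  DirectedClasses E = ∀ p q → E p q → ∃ λ r → E p r × p ≼ r × q ≼ r

  -- (ℙ, 𝒟, Ē) is a model of sweetness with 𝒟 = ℙ
  -- (density of 𝒟 is then automatic)
  record IsSweetnessModel (E : ℕ → Carrier → Carrier → Set) : Set where
    field
      equivalence : ∀ n → IsEquivalence (E n)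
      countable   : ∀ n → CountablyManyClasses (E n)
      directed    : ∀ n → DirectedClasses (E n)
      decreasing  : ∀ n p q → E (suc n) p q → E n p q
      fusion      : (p : ℕ → Carrier) (pω : Carrier) →
                    (∀ i → E i (p i) pω) →
                    ∀ n → ∃ λ q → pω ≼ q × E n q pω × (∀ i → n ≤ i → p i ≼ q)
      continuity  : ∀ p q → p ≼ q → ∀ n → ∃ λ k →
                    ∀ p' → E k p' p → ∃ λ q' → E n q' q × p' ≼ q'

  Compatible : Carrier → Carrier → Set
  Compatible p q = ∃ λ r → p ≼ r × q ≼ r

  IsLub : Carrier → Carrier → Carrier → Set
  IsLub p q r = p ≼ r × q ≼ r × (∀ s → p ≼ s → q ≼ s → r ≼ s)

  CompatibleHaveLubs : Set
  CompatibleHaveLubs = ∀ p q → Compatible p q → ∃ λ r → IsLub p q r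

  -- A family of subsets indexed by a set of codes I; the collection 𝓑 is
  -- { U i : i ∈ I }.
  _∈_ : Carrier → Subset → Set
  x ∈ A = A x

  _⊆_ : Subset → Subset → Set
  A ⊆ B = ∀ x → A x → B x

  _≐_ : Subset → Subset → Set
  A ≐ B = A ⊆ B × B ⊆ A

  _∩_ : Subset → Subset → Subset
  (A ∩ B) x = A x × B x

  module _ {I : Set} (U : I → Subset) where

    CountableFamily : Set
    CountableFamily = Σ (I → ℕ) λ g → ∀ i j → g i ≡ g j → U i ≐ U j

    IsBasis : Set
    IsBasis = (∀ x → ∃ λ i → x ∈ U i)
            × (∀ i j x → x ∈ U i → x ∈ U j → ∃ λ k → x ∈ U k × U k ⊆ (U i ∩ U j))

    ConvergesTo : (ℕ → Carrier) → Carrier → Set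
    ConvergesTo p pω = ∀ i → pω ∈ U i → ∃ λ m → ∀ n → m ≤ n → p n ∈ U i

    record IsIterableSweetnessModel : Set where
      field
        countableFamily : CountableFamily
        basis           : IsBasis
        closedUnderInt  : ∀ i j → ∃ λ k → U k ≐ (U i ∩ U j)
        directedU       : ∀ i x y → x ∈ U i → y ∈ U i →
                          ∃ λ z → z ∈ U i × x ≼ z × y ≼ z
        downwardClosed  : ∀ i p q → p ≼ q → q ∈ U i → p ∈ U i
        limitBound      : ∀ i (p : ℕ → Carrier) (pω : Carrier) →
                          (∀ n → p n ∈ U i) → pω ∈ U i →
                          ConvergesTo p pω →
                          ∃ λ r → r ∈ U i × (∀ n → p n ≼ r) × pω ≼ r

  -- codes for U(p̄, n̄): k together with ⟨p_ℓ : ℓ ≤ k⟩ and ⟨n_ℓ : ℓ ≤ k⟩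
  Code : Set
  Code = Σ ℕ λ k → (Fin (suc k) → Carrier) × (Fin (suc k) → ℕ)

  Uset : (E : ℕ → Carrier → Carrier → Set) → Code → Subset
  Uset E (k , p , n) q = ∀ (ℓ : Fin (suc k)) → ∃ λ q' → E (n ℓ) q' (p ℓ) × q ≼ q'

{-# OPTIONS --safe #-}
module Submission where

-- A code (p̄, n̄) matters only up to the E_{n_ℓ}-classes of the p_ℓ, of which there are
-- countably many, so 𝓑 is countable; concatenating codes intersects the sets. Two members of
-- U(p̄, n̄) have a common bound in each directed class [p_ℓ]_{E_{n_ℓ}}, so they are compatible
-- and their least upper bound stays in U(p̄, n̄).
-- For the limit property, convergence of p_n to p_ω puts, for each j, a tail of the p_n
-- below the directed class [p_ω]_{E_j}. Cutting ℕ into blocks [T j, T (j + 1)) along these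
-- tails, each block has a bound s_j ∈ [p_ω]_{E_j}, and fusion of the s_j yields q ≥ p_ω with
-- q E_M p_ω bounding all s_j for j ≥ M, hence the whole tail from T M. By continuity U(p̄, n̄)
-- contains an E_M-neighbourhood of p_ω for large M, so q ∈ U(p̄, n̄); directedness of U(p̄, n̄)
-- then absorbs the finitely many p_n with n < T M.

open import Defs
open import Data.Nat.Base using (ℕ; zero; suc; _+_; _≤_; _<_; _⊔_; z≤n; s≤s; s≤s⁻¹; _≤′_; ≤′-reflexive; ≤′-step)
open import Data.Nat.Properties
open import Data.Fin.Base using (Fin; zero; suc; splitAt; _↑ˡ_; _↑ʳ_)
open import Data.Fin.Properties using (splitAt-↑ˡ; splitAt-↑ʳ)
open import Data.Vec.Functional using (head; tail; _++_)
open import Data.Product using (∃; _×_; _,_; proj₁; proj₂)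
open import Data.Sum using (inj₁; inj₂; [_,_]′)
open import Data.Empty using (⊥-elim)
open import Function using (const; _∘_)
open import Relation.Nullary using (yes; no)
open import Relation.Binary.PropositionalEquality using (_≡_; refl; cong; subst; sym; trans)
open import Relation.Binary.Structures using (IsEquivalence)

triangle : ℕ → ℕ
triangle zero    = zero
triangle (suc s) = suc (s + triangle s)

-- Cantor's enumeration of ℕ × ℕ: the diagonal a + b = s is walked from (s , 0) to (0 , s).
next : ℕ × ℕ → ℕ × ℕ
next (zero  , b) = (suc b , zero)
next (suc a , b) = (a , suc b)

unpair : ℕ → ℕ × ℕ
unpair zero    = (zero , zero)
unpair (suc n) = next (unpair n)

pair : ℕ → ℕ → ℕ
pair a b = b + triangle (a + b)

unpair-along-diagonal : ∀ s → unpair (triangle s) ≡ (s , zero) →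
                        ∀ a b → a + b ≡ s → unpair (b + triangle s) ≡ (a , b)
unpair-along-diagonal s start a zero    a+0≡s rewrite +-identityʳ a | a+0≡s = start
unpair-along-diagonal s start a (suc b) a+1+b≡s =
  cong next (unpair-along-diagonal s start (suc a) b (trans (sym (+-suc a b)) a+1+b≡s))

unpair-triangle : ∀ s → unpair (triangle s) ≡ (s , zero)
unpair-triangle zero    = refl
unpair-triangle (suc s) = cong next (unpair-along-diagonal s (unpair-triangle s) zero s refl)

unpair-pair : ∀ a b → unpair (pair a b) ≡ (a , b)
unpair-pair a b = unpair-along-diagonal (a + b) (unpair-triangle (a + b)) a b refl

pair-injective : ∀ {a b a′ b′} → pair a b ≡ pair a′ b′ → a ≡ a′ × b ≡ b′
pair-injective {a} {b} {a′} {b′} eq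
  with trans (sym (unpair-pair a b)) (trans (cong unpair eq) (unpair-pair a′ b′))
... | refl = refl , refl

encode : ∀ m → (Fin m → ℕ) → ℕ
encode zero    f = zero
encode (suc m) f = pair (head f) (encode m (tail f))

encode-injective : ∀ m {f g} → encode m f ≡ encode m g → ∀ ℓ → f ℓ ≡ g ℓ
encode-injective (suc m) eq zero    = proj₁ (pair-injective eq)
encode-injective (suc m) eq (suc ℓ) = encode-injective m (proj₂ (pair-injective eq)) ℓ

-- No monotonicity of f is needed: some step from f m to f (d + m) must jump over n.
crossing : (f : ℕ → ℕ) {m n : ℕ} (d : ℕ) → f m ≤ n → n < f (d + m) →
           ∃ λ j → m ≤ j × f j ≤ n × n < f (suc j)
crossing f zero    fm≤n n<fm = ⊥-elim (<⇒≱ n<fm fm≤n)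
crossing f {m} {n} (suc d) fm≤n n<f1+d+m with n <? f (d + m)
... | yes n<fd+m = crossing f d fm≤n n<fd+m
... | no  n≮fd+m = d + m , m≤n+m m d , ≮⇒≥ n≮fd+m , n<f1+d+m

module _ (ℙ : ForcingNotion) where
  open ForcingNotion ℙ

  IsDirected : Subset ℙ → Set
  IsDirected D = ∀ x y → D x → D y → ∃ λ z → D z × x ≼ z × y ≼ z

  Below : Subset ℙ → Subset ℙ
  Below D x = ∃ λ w → D w × x ≼ w

  below-bounded : ∀ {D x y} → IsDirected D → Below D x → Below D y →
                  ∃ λ z → D z × x ≼ z × y ≼ z
  below-bounded dir (v , v∈D , x≼v) (w , w∈D , y≼w) with dir v w v∈D w∈D
  ... | z , z∈D , v≼z , w≼z = z , z∈D , ≼-trans x≼v v≼z , ≼-trans y≼w w≼z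

  bound-on-interval : ∀ {D c} → IsDirected D → D c → (x : ℕ → Carrier) (a b : ℕ) →
                      (∀ n → a ≤ n → n < b → Below D (x n)) →
                      ∃ λ u → D u × c ≼ u × (∀ n → a ≤ n → n < b → x n ≼ u)
  bound-on-interval dir c∈D x a zero    below = _ , c∈D , ≼-refl , λ _ _ ()
  bound-on-interval dir c∈D x a (suc b) below
    with bound-on-interval dir c∈D x a b (λ n a≤n n<b → below n a≤n (m<n⇒m<1+n n<b)) | a ≤? b
  ... | u , u∈D , c≼u , bound | no a≰b =
    u , u∈D , c≼u , λ n a≤n n<1+b → bound n a≤n (≤∧≢⇒< (s≤s⁻¹ n<1+b) λ { refl → a≰b a≤n })
  ... | u , u∈D , c≼u , bound | yes a≤b with below-bounded dir (u , u∈D , ≼-refl) (below b a≤b (n<1+n b))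
  ... | z , z∈D , u≼z , xb≼z =
    z , z∈D , ≼-trans c≼u u≼z ,
    λ n a≤n n<1+b → [ (λ n<b → ≼-trans (bound n a≤n n<b) u≼z) , (λ { refl → xb≼z }) ]′
                      (m<1+n⇒m<n∨m≡n n<1+b)

  module Classes {E : Carrier → Carrier → Set} (equivalence : IsEquivalence E) where
    open IsEquivalence equivalence public using () renaming (refl to E-refl; sym to E-sym; trans to E-trans)

    class : Carrier → Subset ℙ
    class a w = E w a

    class-directed : DirectedClasses ℙ E → ∀ a → IsDirected (class a)
    class-directed directed a v w v∈a w∈a with directed v w (E-trans v∈a (E-sym w∈a))
    ... | z , v~z , v≼z , w≼z = z , E-trans (E-sym v~z) v∈a , v≼z , w≼z

  module Sweetness {E : ℕ → Carrier → Carrier → Set} (sweet : IsSweetnessModel ℙ E) where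
    open IsSweetnessModel sweet

    module _ {n : ℕ} where
      open Classes (equivalence n) public

    E-antitone : ∀ {m n a b} → m ≤ n → E n a b → E m a b
    E-antitone m≤n = go (≤⇒≤′ m≤n)
      where
      go : ∀ {m n a b} → m ≤′ n → E n a b → E m a b
      go (≤′-reflexive refl) e = e
      go (≤′-step m≤′n)      e = go m≤′n (decreasing _ _ _ e)

    U : Code ℙ → Subset ℙ
    U = Uset ℙ E

    ball : Carrier → ℕ → Code ℙ
    ball a j = zero , const a , const j

    ball-centre : ∀ a j → U (ball a j) a
    ball-centre a j _ = a , E-refl , ≼-refl

    U-downward : ∀ c x y → x ≼ y → U c y → U c x
    U-downward c x y x≼y y∈U ℓ with y∈U ℓ
    ... | w , w∈class , y≼w = w , w∈class , ≼-trans x≼y y≼w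

    constraint : (c : Code ℙ) → Fin (suc (proj₁ c)) → Subset ℙ
    constraint (k , p , n) ℓ = class {n ℓ} (p ℓ)

    U-common-bound : ∀ c {x y} → U c x → U c y → ∀ ℓ → ∃ λ r → constraint c ℓ r × x ≼ r × y ≼ r
    U-common-bound (k , p , n) x∈U y∈U ℓ =
      below-bounded (class-directed (directed (n ℓ)) (p ℓ)) (x∈U ℓ) (y∈U ℓ)

    U-directed : CompatibleHaveLubs ℙ → ∀ c → IsDirected (U c)
    U-directed lubs c x y x∈U y∈U
      with lubs x y (let r , _ , x≼r , y≼r = U-common-bound c x∈U y∈U zero in r , x≼r , y≼r)
    ... | z , x≼z , y≼z , least =
      z , (λ ℓ → let r , r∈cℓ , x≼r , y≼r = U-common-bound c x∈U y∈U ℓ in r , r∈cℓ , least r x≼r y≼r) ,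
      x≼z , y≼z

    _⊕_ : Code ℙ → Code ℙ → Code ℙ
    (k , p , n) ⊕ (k′ , p′ , n′) = k + suc k′ , p ++ p′ , n ++ n′

    ⊕-⊆-∩ : ∀ c c′ x → U (c ⊕ c′) x → U c x × U c′ x
    ⊕-⊆-∩ (k , p , n) (k′ , p′ , n′) x x∈U =
      (λ ℓ → subst (λ i → Below (class {[ n , n′ ]′ i} ([ p , p′ ]′ i)) x)
                   (splitAt-↑ˡ (suc k) ℓ (suc k′)) (x∈U (ℓ ↑ˡ suc k′))) ,
      (λ ℓ → subst (λ i → Below (class {[ n , n′ ]′ i} ([ p , p′ ]′ i)) x)
                   (splitAt-↑ʳ (suc k) (suc k′) ℓ) (x∈U (suc k ↑ʳ ℓ)))

    ∩-⊆-⊕ : ∀ c c′ x → U c x × U c′ x → U (c ⊕ c′) x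
    ∩-⊆-⊕ (k , p , n) (k′ , p′ , n′) x (x∈U , x∈U′) ℓ with splitAt (suc k) ℓ
    ... | inj₁ i = x∈U i
    ... | inj₂ i = x∈U′ i

    class-index : ℕ → Carrier → ℕ
    class-index m = proj₁ (countable m)

    class-codes : (c : Code ℙ) → Fin (suc (proj₁ c)) → ℕ
    class-codes (k , p , n) ℓ = pair (n ℓ) (class-index (n ℓ) (p ℓ))

    index : Code ℙ → ℕ
    index c = pair (proj₁ c) (encode _ (class-codes c))

    below-same-class : ∀ m m′ a a′ → pair m (class-index m a) ≡ pair m′ (class-index m′ a′) →
                       ∀ x → Below (class {m} a) x → Below (class {m′} a′) x
    below-same-class m m′ a a′ eq x (w , w~a , x≼w)
      with pair-injective {m} {class-index m a} {m′} {class-index m′ a′} eq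
    ... | refl , indices≡ = w , E-trans w~a (proj₂ (countable m) a a′ indices≡) , x≼w

    index-sound : ∀ c c′ → index c ≡ index c′ → ∀ x → U c x → U c′ x
    index-sound c@(k , p , n) c′@(k′ , p′ , n′) eq x x∈U
      with pair-injective {k} {encode _ (class-codes c)} {k′} {encode _ (class-codes c′)} eq
    ... | refl , codes≡ =
      λ ℓ → below-same-class (n ℓ) (n′ ℓ) (p ℓ) (p′ ℓ)
                             (encode-injective (suc k) {class-codes c} {class-codes c′} codes≡ ℓ) x (x∈U ℓ)

    Neighbourhood : Subset ℙ → Carrier → Set
    Neighbourhood A x = ∃ λ k → ∀ y → E k y x → A y

    neighbourhood-∀ : ∀ m {A : Fin m → Subset ℙ} {x} → (∀ ℓ → Neighbourhood (A ℓ) x) →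
                      Neighbourhood (λ y → ∀ ℓ → A ℓ y) x
    neighbourhood-∀ zero    nbhd = zero , λ _ _ ()
    neighbourhood-∀ (suc m) nbhd with nbhd zero | neighbourhood-∀ m (nbhd ∘ suc)
    ... | k , head-nbhd | k′ , tail-nbhd = k ⊔ k′ , λ y y~x → λ
      { zero    → head-nbhd y (E-antitone (m≤m⊔n k k′) y~x)
      ; (suc ℓ) → tail-nbhd y (E-antitone (m≤n⊔m k k′) y~x) ℓ
      }

    below-class-neighbourhood : ∀ {n a x} → Below (class {n} a) x → Neighbourhood (Below (class {n} a)) x
    below-class-neighbourhood {n} {x = x} (w , w~a , x≼w) with continuity x w x≼w n
    ... | k , lift = k , λ y y~x → let w′ , w′~w , y≼w′ = lift y y~x in w′ , E-trans w′~w w~a , y≼w′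

    U-neighbourhood : ∀ c {x} → U c x → Neighbourhood (U c) x
    U-neighbourhood (k , p , n) x∈U = neighbourhood-∀ (suc k) (λ ℓ → below-class-neighbourhood (x∈U ℓ))

    module Limit (c : Code ℙ) (U-dir : IsDirected (U c)) (p : ℕ → Carrier) (pω : Carrier)
                 (p∈U : ∀ n → U c (p n)) (pω∈U : U c pω) (p→pω : ConvergesTo ℙ U p pω) where

      eventually-below-class : ∀ j → ∃ λ N → ∀ n → N ≤ n → Below (class {j} pω) (p n)
      eventually-below-class j with p→pω (ball pω j) (ball-centre pω j)
      ... | N , tail = N , λ n N≤n → tail n N≤n zero

      T : ℕ → ℕ
      T j = proj₁ (eventually-below-class j) ⊔ j

      block-bound : ∀ j → ∃ λ s → E j s pω × (∀ n → T j ≤ n → n < T (suc j) → p n ≼ s)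
      block-bound j with bound-on-interval (class-directed (directed j) pω) E-refl p (T j) (T (suc j))
                           (λ n Tj≤n _ → proj₂ (eventually-below-class j) n (≤-trans (m≤m⊔n _ j) Tj≤n))
      ... | s , s~pω , _ , bound = s , s~pω , bound

      s : ℕ → Carrier
      s j = proj₁ (block-bound j)

      s~pω : ∀ j → E j (s j) pω
      s~pω j = proj₁ (proj₂ (block-bound j))

      block-below-s : ∀ j n → T j ≤ n → n < T (suc j) → p n ≼ s j
      block-below-s j = proj₂ (proj₂ (block-bound j))

      M : ℕ
      M = proj₁ (U-neighbourhood c pω∈U)

      -- T j ≥ j, so every n ≥ T M lies in a block [T j, T (j + 1)) with M ≤ j.
      tail-below : ∀ q → (∀ j → M ≤ j → s j ≼ q) → ∀ n → T M ≤ n → p n ≼ q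
      tail-below q s≼q n TM≤n with crossing T (suc n) TM≤n (≤-trans (s≤s (m≤m+n n M)) (m≤n⊔m _ _))
      ... | j , M≤j , Tj≤n , n<T1+j = ≼-trans (block-below-s j n Tj≤n n<T1+j) (s≼q j M≤j)

      upper-bound : ∃ λ r → U c r × (∀ n → p n ≼ r) × pω ≼ r
      upper-bound with fusion s pω s~pω M
      ... | q , pω≼q , q~pω , s≼q
        with bound-on-interval U-dir (proj₂ (U-neighbourhood c pω∈U) q q~pω) p 0 (T M)
                               (λ n _ _ → p n , p∈U n , ≼-refl)
      ... | r , r∈U , q≼r , initial-below = r , r∈U , below-r , ≼-trans pω≼q q≼r
        where
        below-r : ∀ n → p n ≼ r
        below-r n with n <? T M
        ... | yes n<TM = initial-below n z≤n n<TM
        ... | no  n≮TM = ≼-trans (tail-below q s≼q n (≮⇒≥ n≮TM)) q≼r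

proposition5p7 : (ℙ : ForcingNotion) (E : ℕ → ForcingNotion.Carrier ℙ → ForcingNotion.Carrier ℙ → Set) →
                 IsSweetnessModel ℙ E → CompatibleHaveLubs ℙ →
                 IsIterableSweetnessModel ℙ (Uset ℙ E)
proposition5p7 ℙ E sweet lubs = record
  { countableFamily = index , λ c c′ eq → index-sound c c′ eq , index-sound c′ c (sym eq)
  ; basis           = (λ x → ball x zero , ball-centre x zero)
                    , (λ c c′ x x∈U x∈U′ → c ⊕ c′ , ∩-⊆-⊕ c c′ x (x∈U , x∈U′) , ⊕-⊆-∩ c c′)
  ; closedUnderInt  = λ c c′ → c ⊕ c′ , ⊕-⊆-∩ c c′ , ∩-⊆-⊕ c c′
  ; directedU       = U-directed lubs
  ; downwardClosed  = U-downward
  ; limitBound      = λ c → Limit.upper-bound c (U-directed lubs c)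
  }
  where open Sweetness ℙ sweet
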